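{- In the logic DmBL, for all $\phi,\psi,\eta\in\mathcal{L}$: $\vdash\Box(\psi\leftrightarrow\eta)\rightarrow\Box\bigl((\phi|\psi)\leftrightarrow(\phi|\eta)\bigr)$ (this is proved using axiom b5, without assuming b5.weak.B). Consequently, axiom b5 implies b5.weak.B (so DmBL$_\ast$ is weaker than DmBL), and $\psi\equiv\eta$ implies $(\phi|\psi)\equiv(\phi|\eta)$.
   Context: Fix a set $\Theta$ of atomic propositions. The language $\mathcal{L}$ is the smallest set containing $\Theta$ and closed under the formation of $\neg\phi$, $\Box\phi$, $\phi\rightarrow\psi$ and the conditional $(\psi|\phi)$. Abbreviations: $\phi\vee\psi=\neg\phi\rightarrow\psi$, $\phi\wedge\psi=\neg(\neg\phi\vee\neg\psi)$, $\phi\leftrightarrow\psi=(\phi\rightarrow\psi)\wedge(\psi\rightarrow\phi)$, $\top=\theta_0\rightarrow\theta_0$ for a fixed $\theta_0\in\Theta$, $\bot=\neg\top$, $\Diamond\phi=\neg\Box\neg\phi$, and (logical independence) $\psi\times\phi=\Box\bigl((\psi|\phi)\leftrightarrow\psi\bigr)$. The theorems ($\vdash$) of DmBL are the smallest set containing all instances of the axiom schemes below and closed under modus ponens (from $\vdash\phi$ and $\vdash\phi\rightarrow\psi$ infer $\vdash\psi$) and necessitation m1 (from $\vdash\phi$ infer $\vdash\Box\phi$): c1 $\phi\rightarrow(\psi\rightarrow\phi)$; c2 $(\eta\rightarrow(\phi\rightarrow\psi))\rightarrow((\eta\rightarrow\phi)\rightarrow(\eta\rightarrow\psi))$; c3 $(\neg\phi\rightarrow\neg\psi)\rightarrow((\neg\phi\rightarrow\psi)\rightarrow\phi)$;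 m2 $\Box(\phi\rightarrow\psi)\rightarrow(\Box\phi\rightarrow\Box\psi)$; m3 $\Box\phi\rightarrow\phi$; b1 $\Box(\phi\rightarrow\psi)\rightarrow(\Box\neg\phi\vee\Box(\psi|\phi))$; b2 $((\psi\rightarrow\eta)|\phi)\rightarrow((\psi|\phi)\rightarrow(\eta|\phi))$; b3 $(\psi|\phi)\rightarrow(\phi\rightarrow\psi)$; b4 $\neg(\neg\psi|\phi)\leftrightarrow(\psi|\phi)$; b5 $(\psi\times\phi)\leftrightarrow(\phi\times\psi)$. The logic DmBL$_\ast$ is defined in the same way but with b5 replaced by the two schemes b5.weak.A $(\psi\times\neg\phi)\leftrightarrow(\psi\times\phi)$ and b5.weak.B $\Box(\psi\leftrightarrow\eta)\rightarrow\Box((\phi|\psi)\leftrightarrow(\phi|\eta))$. $\phi\equiv\psi$ means $\vdash\phi\leftrightarrow\psi$. -}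

module Defs where

open import Data.Product using (_×_)

data Form (Θ : Set) : Set where
  atom : Θ → Form Θ
  ¬'_  : Form Θ → Form Θ
  □_   : Form Θ → Form Θ
  _⇒_  : Form Θ → Form Θ → Form Θ
  -- cond ψ φ  is the conditional (ψ | φ)
  cond : Form Θ → Form Θ → Form Θ

infixr 30 _⇒_
infix 40 ¬'_ □_

module Abbrev {Θ : Set} (θ₀ : Θ) where
  _∨'_ : Form Θ → Form Θ → Form Θ
  φ ∨' ψ = (¬' φ) ⇒ ψ

  _∧'_ : Form Θ → Form Θ → Form Θ
  φ ∧' ψ = ¬' ((¬' φ) ∨' (¬' ψ))

  _⇔_ : Form Θ → Form Θ → Form Θ
  φ ⇔ ψ = (φ ⇒ ψ) ∧' (ψ ⇒ φ)

  ⊤' : Form Θ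
  ⊤' = atom θ₀ ⇒ atom θ₀

  ⊥' : Form Θ
  ⊥' = ¬' ⊤'

  ◇_ : Form Θ → Form Θ
  ◇ φ = ¬' (□ (¬' φ))

  indep : Form Θ → Form Θ → Form Θ
  indep ψ φ = □ (cond ψ φ ⇔ ψ)

  data ⊢ : Form Θ → Set where
    c1 : ∀ φ ψ → ⊢ (φ ⇒ (ψ ⇒ φ))
    c2 : ∀ η φ ψ → ⊢ ((η ⇒ (φ ⇒ ψ)) ⇒ ((η ⇒ φ) ⇒ (η ⇒ ψ)))
    c3 : ∀ φ ψ → ⊢ (((¬' φ) ⇒ (¬' ψ)) ⇒ (((¬' φ) ⇒ ψ) ⇒ φ))
    m2 : ∀ φ ψ → ⊢ (□ (φ ⇒ ψ) ⇒ (□ φ ⇒ □ ψ))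
    m3 : ∀ φ → ⊢ (□ φ ⇒ φ)
    b1 : ∀ φ ψ → ⊢ (□ (φ ⇒ ψ) ⇒ ((□ (¬' φ)) ∨' (□ (cond ψ φ))))
    b2 : ∀ φ ψ η → ⊢ (cond (ψ ⇒ η) φ ⇒ (cond ψ φ ⇒ cond η φ))
    b3 : ∀ φ ψ → ⊢ (cond ψ φ ⇒ (φ ⇒ ψ))
    b4 : ∀ φ ψ → ⊢ ((¬' (cond (¬' ψ) φ)) ⇔ cond ψ φ)
    b5 : ∀ φ ψ → ⊢ (indep ψ φ ⇔ indep φ ψ)
    mp : ∀ {φ ψ} → ⊢ φ → ⊢ (φ ⇒ ψ) → ⊢ ψ
    m1 : ∀ {φ} → ⊢ φ → ⊢ (□ φ)

  data ⊢∗ : Form Θ → Set where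
    c1 : ∀ φ ψ → ⊢∗ (φ ⇒ (ψ ⇒ φ))
    c2 : ∀ η φ ψ → ⊢∗ ((η ⇒ (φ ⇒ ψ)) ⇒ ((η ⇒ φ) ⇒ (η ⇒ ψ)))
    c3 : ∀ φ ψ → ⊢∗ (((¬' φ) ⇒ (¬' ψ)) ⇒ (((¬' φ) ⇒ ψ) ⇒ φ))
    m2 : ∀ φ ψ → ⊢∗ (□ (φ ⇒ ψ) ⇒ (□ φ ⇒ □ ψ))
    m3 : ∀ φ → ⊢∗ (□ φ ⇒ φ)
    b1 : ∀ φ ψ → ⊢∗ (□ (φ ⇒ ψ) ⇒ ((□ (¬' φ)) ∨' (□ (cond ψ φ))))
    b2 : ∀ φ ψ η → ⊢∗ (cond (ψ ⇒ η) φ ⇒ (cond ψ φ ⇒ cond η φ))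
    b3 : ∀ φ ψ → ⊢∗ (cond ψ φ ⇒ (φ ⇒ ψ))
    b4 : ∀ φ ψ → ⊢∗ ((¬' (cond (¬' ψ) φ)) ⇔ cond ψ φ)
    b5wA : ∀ φ ψ → ⊢∗ (indep ψ (¬' φ) ⇔ indep ψ φ)
    b5wB : ∀ φ ψ η → ⊢∗ (□ (ψ ⇔ η) ⇒ □ (cond φ ψ ⇔ cond φ η))
    mp : ∀ {φ ψ} → ⊢∗ φ → ⊢∗ (φ ⇒ ψ) → ⊢∗ ψ
    m1 : ∀ {φ} → ⊢∗ φ → ⊢∗ (□ φ)

  _≡L_ : Form Θ → Form Θ → Set
  φ ≡L ψ = ⊢ (φ ⇔ ψ)

{-# OPTIONS --safe #-}
-- An impossible event is independent of everything, and a conditional (φ|ψ)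
-- is independent of its own antecedent: if ◇ψ, then b1 and b2 turn
-- □(ψ → ((φ|ψ) ↔ φ)) into □(((φ|ψ)|ψ) ↔ (φ|ψ)). With the symmetry b5,
-- independence is preserved when either side is replaced by a necessarily
-- equivalent formula. So from □(ψ ↔ η) and ◇ψ we get (φ|ψ) × η, that is
-- □(((φ|ψ)|η) ↔ (φ|ψ)), while b1 and b2 give □(((φ|ψ)|η) ↔ (φ|η)) since η is
-- possible too and forces (φ|ψ) ↔ φ. If instead □¬ψ, then □¬η, and both
-- conditionals are necessarily equivalent to φ.
module Submission where

open import Data.Bool using (Bool; true; false; T; not; _∧_; _∨_)
open import Data.Bool.Properties using (T-∧)
open import Data.Fin using (Fin; zero; suc)
open import Data.List using (List; []; _∷_)
open import Data.List.Membership.Propositional using (_∈_)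
open import Data.List.Relation.Unary.Any using (here; there)
open import Data.Nat using (ℕ; zero; suc)
open import Data.Product using (_×_; _,_; proj₁; proj₂)
open import Data.Unit using (tt)
open import Data.Vec using (Vec; []; _∷_; lookup)
open import Function.Bundles using (Equivalence)
open import Relation.Binary.PropositionalEquality using (refl)

open import Defs

module Hilbert {Θ : Set} (Thm : Form Θ → Set)
  (c1 : ∀ φ ψ → Thm (φ ⇒ (ψ ⇒ φ)))
  (c2 : ∀ η φ ψ → Thm ((η ⇒ (φ ⇒ ψ)) ⇒ ((η ⇒ φ) ⇒ (η ⇒ ψ))))
  (c3 : ∀ φ ψ → Thm (((¬' φ) ⇒ (¬' ψ)) ⇒ (((¬' φ) ⇒ ψ) ⇒ φ)))
  (mp : ∀ {φ ψ} → Thm φ → Thm (φ ⇒ ψ) → Thm ψ)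
  where

  private variable
    n : ℕ
    φ ψ : Form Θ
    Γ : List (Form Θ)

  infix  2 _⊩_
  infixl 5 _·_

  data _⊩_ (Γ : List (Form Θ)) : Form Θ → Set where
    hyp : φ ∈ Γ → Γ ⊩ φ
    thm : Thm φ → Γ ⊩ φ
    _·_ : Γ ⊩ (φ ⇒ ψ) → Γ ⊩ φ → Γ ⊩ ψ

  theorem : [] ⊩ φ → Thm φ
  theorem (thm t) = t
  theorem (d · e) = mp (theorem e) (theorem d)

  weaken : Γ ⊩ φ → (ψ ∷ Γ) ⊩ φ
  weaken (hyp i) = hyp (there i)
  weaken (thm t) = thm t
  weaken (d · e) = weaken d · weaken e

  hyp₀ : (φ ∷ Γ) ⊩ φ
  hyp₀ = hyp (here refl)

  hyp₁ : (ψ ∷ φ ∷ Γ) ⊩ φ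
  hyp₁ = weaken hyp₀

  ⇒-refl : ∀ φ → Thm (φ ⇒ φ)
  ⇒-refl φ = mp (c1 φ φ) (mp (c1 φ (φ ⇒ φ)) (c2 φ (φ ⇒ φ) φ))

  deduction : (φ ∷ Γ) ⊩ ψ → Γ ⊩ (φ ⇒ ψ)
  deduction (hyp (here refl)) = thm (⇒-refl _)
  deduction (hyp (there i))   = thm (c1 _ _) · hyp i
  deduction (thm t)           = thm (c1 _ _) · thm t
  deduction (d · e)           = thm (c2 _ _ _) · deduction d · deduction e

  ¬¬-elim : ∀ φ → Thm (¬' ¬' φ ⇒ φ)
  ¬¬-elim φ = theorem (deduction (thm (c3 φ (¬' φ)) · (thm (c1 _ _) · hyp₀) · thm (⇒-refl _)))

  ¬¬-intro : ∀ φ → Thm (φ ⇒ ¬' ¬' φ)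
  ¬¬-intro φ = theorem (deduction (thm (c3 (¬' ¬' φ) φ) · thm (¬¬-elim _) · (thm (c1 _ _) · hyp₀)))

  explosion : ∀ φ ψ → Thm (¬' φ ⇒ (φ ⇒ ψ))
  explosion φ ψ = theorem (deduction (deduction
    (thm (c3 ψ φ) · (thm (c1 _ _) · hyp₁) · (thm (c1 _ _) · hyp₀))))

  contraposition : ∀ φ ψ → Thm ((φ ⇒ ψ) ⇒ (¬' ψ ⇒ ¬' φ))
  contraposition φ ψ = theorem (deduction (deduction
    (thm (c3 (¬' φ) ψ) · (thm (c1 _ _) · hyp₀)
                       · deduction (weaken hyp₁ · (thm (¬¬-elim φ) · hyp₀)))))

  ¬⇒-intro : ∀ φ ψ → Thm (φ ⇒ (¬' ψ ⇒ ¬' (φ ⇒ ψ)))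
  ¬⇒-intro φ ψ = theorem (deduction (thm (contraposition (φ ⇒ ψ) ψ) · deduction (hyp₀ · hyp₁)))

  byCases : ∀ χ → (χ ∷ Γ) ⊩ φ → (¬' χ ∷ Γ) ⊩ φ → Γ ⊩ φ
  byCases χ d e =
    thm (c3 _ _) · (thm (contraposition _ _) · deduction e)
                 · (thm (contraposition _ _) · deduction d)

  infix  7 ~_
  infix  6 _⟺_
  infixr 4 _⟹_

  data PropForm (n : ℕ) : Set where
    var  : Fin n → PropForm n
    ~_   : PropForm n → PropForm n
    _⟹_ : PropForm n → PropForm n → PropForm n

  -- Spelled out as Abbrev._⇔_, so that ⟦ p ⟺ q ⟧ ρ is definitionally ⟦ p ⟧ ρ ⇔ ⟦ q ⟧ ρ.
  _⟺_ : PropForm n → PropForm n → PropForm n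
  p ⟺ q = ~ (~ ~ (p ⟹ q) ⟹ ~ (q ⟹ p))

  x₀ : PropForm (suc n)
  x₀ = var zero

  x₁ : PropForm (suc (suc n))
  x₁ = var (suc zero)

  x₂ : PropForm (suc (suc (suc n)))
  x₂ = var (suc (suc zero))

  x₃ : PropForm (suc (suc (suc (suc n))))
  x₃ = var (suc (suc (suc zero)))

  ⟦_⟧ : PropForm n → Vec (Form Θ) n → Form Θ
  ⟦ var i ⟧ ρ = lookup ρ i
  ⟦ ~ p ⟧   ρ = ¬' ⟦ p ⟧ ρ
  ⟦ p ⟹ q ⟧ ρ = ⟦ p ⟧ ρ ⇒ ⟦ q ⟧ ρ

  eval : Vec Bool n → PropForm n → Bool
  eval v (var i) = lookup v i
  eval v (~ p)   = not (eval v p)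
  eval v (p ⟹ q) = not (eval v p) ∨ eval v q

  literal : Bool → Form Θ → Form Θ
  literal true  φ = φ
  literal false φ = ¬' φ

  literals : Vec Bool n → Vec (Form Θ) n → List (Form Θ)
  literals []      []      = []
  literals (b ∷ v) (φ ∷ ρ) = literal b φ ∷ literals v ρ

  literal∈literals : (v : Vec Bool n) (ρ : Vec (Form Θ) n) (i : Fin n) →
                     literal (lookup v i) (lookup ρ i) ∈ literals v ρ
  literal∈literals (b ∷ v) (φ ∷ ρ) zero    = here refl
  literal∈literals (b ∷ v) (φ ∷ ρ) (suc i) = there (literal∈literals v ρ i)

  kalmar : (v : Vec Bool n) (ρ : Vec (Form Θ) n) (p : PropForm n) →
           literals v ρ ⊩ literal (eval v p) (⟦ p ⟧ ρ)
  kalmar v ρ (var i) = hyp (literal∈literals v ρ i)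
  kalmar v ρ (~ p) with eval v p | kalmar v ρ p
  ... | true  | ⊩p  = thm (¬¬-intro _) · ⊩p
  ... | false | ⊩¬p = ⊩¬p
  kalmar v ρ (p ⟹ q) with eval v p | kalmar v ρ p | eval v q | kalmar v ρ q
  ... | false | ⊩¬p | _     | _    = thm (explosion _ _) · ⊩¬p
  ... | true  | _   | true  | ⊩q  = thm (c1 _ _) · ⊩q
  ... | true  | ⊩p  | false | ⊩¬q = thm (¬⇒-intro _ _) · ⊩p · ⊩¬q

  literals-elim : (ρ : Vec (Form Θ) n) → (∀ v → literals v ρ ⊩ φ) → [] ⊩ φ
  literals-elim []      ⊩φ = ⊩φ []
  literals-elim (ψ ∷ ρ) ⊩φ = literals-elim ρ λ v → byCases ψ (⊩φ (true ∷ v)) (⊩φ (false ∷ v))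

  literal-true : ∀ b → T b → Γ ⊩ literal b φ → Γ ⊩ φ
  literal-true true _ d = d

  every : (n : ℕ) → (Vec Bool n → Bool) → Bool
  every zero    f = f []
  every (suc n) f = every n (λ v → f (true ∷ v)) ∧ every n (λ v → f (false ∷ v))

  every-sound : ∀ n (f : Vec Bool n → Bool) → T (every n f) → ∀ v → T (f v)
  every-sound zero    f h []          = h
  every-sound (suc n) f h (true ∷ v)  = every-sound n _ (proj₁ (Equivalence.to T-∧ h)) v
  every-sound (suc n) f h (false ∷ v) = every-sound n _ (proj₂ (Equivalence.to T-∧ h)) v

  tautology : (p : PropForm n) (ρ : Vec (Form Θ) n) → T (every n (λ v → eval v p)) → Thm (⟦ p ⟧ ρ)
  tautology {n} p ρ h = theorem (literals-elim ρ λ v →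
    literal-true (eval v p) (every-sound n _ h v) (kalmar v ρ p))

module DmBL {Θ : Set} (θ₀ : Θ) where
  open Abbrev θ₀
  open Hilbert ⊢ c1 c2 c3 mp public

  private variable
    φ ψ η χ : Form Θ
    Γ : List (Form Θ)

  ⇔-to : ∀ φ ψ → ⊢ ((φ ⇔ ψ) ⇒ (φ ⇒ ψ))
  ⇔-to φ ψ = tautology (x₀ ⟺ x₁ ⟹ x₀ ⟹ x₁) (φ ∷ ψ ∷ []) tt

  □-map : ⊢ (φ ⇒ ψ) → Γ ⊩ □ φ → Γ ⊩ □ ψ
  □-map t □φ = thm (m2 _ _) · thm (m1 t) · □φ

  □-map₂ : ⊢ (φ ⇒ ψ ⇒ η) → Γ ⊩ □ φ → Γ ⊩ □ ψ → Γ ⊩ □ η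
  □-map₂ t □φ □ψ = thm (m2 _ _) · □-map t □φ · □ψ

  □-map₃ : ⊢ (φ ⇒ ψ ⇒ η ⇒ χ) → Γ ⊩ □ φ → Γ ⊩ □ ψ → Γ ⊩ □ η → Γ ⊩ □ χ
  □-map₃ t □φ □ψ □η = thm (m2 _ _) · □-map₂ t □φ □ψ · □η

  □⇔-intro : Γ ⊩ □ (φ ⇒ ψ) → Γ ⊩ □ (ψ ⇒ φ) → Γ ⊩ □ (φ ⇔ ψ)
  □⇔-intro {φ = φ} {ψ} =
    □-map₂ (tautology ((x₀ ⟹ x₁) ⟹ (x₁ ⟹ x₀) ⟹ x₀ ⟺ x₁) (φ ∷ ψ ∷ []) tt)

  □⇔-sym : Γ ⊩ □ (φ ⇔ ψ) → Γ ⊩ □ (ψ ⇔ φ)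
  □⇔-sym {φ = φ} {ψ} = □-map (tautology (x₀ ⟺ x₁ ⟹ x₁ ⟺ x₀) (φ ∷ ψ ∷ []) tt)

  □⇔-trans : Γ ⊩ □ (φ ⇔ ψ) → Γ ⊩ □ (ψ ⇔ η) → Γ ⊩ □ (φ ⇔ η)
  □⇔-trans {φ = φ} {ψ} {η} =
    □-map₂ (tautology (x₀ ⟺ x₁ ⟹ x₁ ⟺ x₂ ⟹ x₀ ⟺ x₂) (φ ∷ ψ ∷ η ∷ []) tt)

  □⇒◇ : Γ ⊩ □ φ → Γ ⊩ ◇ φ
  □⇒◇ {φ = φ} □φ =
    thm (tautology ((x₀ ⟹ x₁) ⟹ (x₂ ⟹ ~ x₁) ⟹ x₀ ⟹ ~ x₂) (□ φ ∷ φ ∷ □ (¬' φ) ∷ []) tt)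
      · thm (m3 _) · thm (m3 _) · □φ

  ◇-map : Γ ⊩ □ (φ ⇒ ψ) → Γ ⊩ ◇ φ → Γ ⊩ ◇ ψ
  ◇-map □φ⇒ψ ◇φ =
    thm (contraposition _ _) · (thm (m2 _ _) · □-map (contraposition _ _) □φ⇒ψ) · ◇φ

  □-cond : Γ ⊩ ◇ φ → Γ ⊩ □ (φ ⇒ ψ) → Γ ⊩ □ (cond ψ φ)
  □-cond ◇φ □φ⇒ψ = thm (b1 _ _) · □φ⇒ψ · ◇φ

  □-cond-⇒ : Γ ⊩ ◇ φ → Γ ⊩ □ (φ ⇒ ψ ⇒ η) → Γ ⊩ □ (cond ψ φ ⇒ cond η φ)
  □-cond-⇒ ◇φ □φ⇒ψ⇒η = □-map (b2 _ _ _) (□-cond ◇φ □φ⇒ψ⇒η)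

  □-cond-cong : Γ ⊩ ◇ φ → Γ ⊩ □ (φ ⇒ (ψ ⇔ η)) → Γ ⊩ □ (cond ψ φ ⇔ cond η φ)
  □-cond-cong {φ = φ} {ψ} {η} ◇φ □φ⇒ψ⇔η = □⇔-intro
    (□-cond-⇒ ◇φ (□-map (tautology ((x₀ ⟹ x₁ ⟺ x₂) ⟹ x₀ ⟹ x₁ ⟹ x₂) (φ ∷ ψ ∷ η ∷ []) tt) □φ⇒ψ⇔η))
    (□-cond-⇒ ◇φ (□-map (tautology ((x₀ ⟹ x₁ ⟺ x₂) ⟹ x₀ ⟹ x₂ ⟹ x₁) (φ ∷ ψ ∷ η ∷ []) tt) □φ⇒ψ⇔η))

  antecedent⇒cond⇔ : ⊢ (φ ⇒ (cond ψ φ ⇔ ψ))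
  antecedent⇒cond⇔ {φ} {ψ} = theorem
    (thm (tautology ((x₂ ⟹ x₀ ⟹ x₁) ⟹ (x₃ ⟹ x₀ ⟹ ~ x₁) ⟹ (~ x₃ ⟺ x₂) ⟹ x₀ ⟹ x₂ ⟺ x₁)
                    (φ ∷ ψ ∷ cond ψ φ ∷ cond (¬' ψ) φ ∷ []) tt)
      · thm (b3 _ _) · thm (b3 _ _) · thm (b4 _ _))

  indep-sym : Γ ⊩ indep ψ φ → Γ ⊩ indep φ ψ
  indep-sym ψ×φ = thm (⇔-to _ _) · thm (b5 _ _) · ψ×φ

  indep-¬ : Γ ⊩ indep (¬' ψ) φ → Γ ⊩ indep ψ φ
  indep-¬ {ψ = ψ} {φ} =
    □-map₂ (tautology (~ x₀ ⟺ x₁ ⟹ x₀ ⟺ ~ x₂ ⟹ x₁ ⟺ x₂) (cond (¬' ψ) φ ∷ cond ψ φ ∷ ψ ∷ []) tt)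
      (thm (m1 (b4 _ _)))

  impossible-indep : Γ ⊩ ◇ φ → Γ ⊩ □ (¬' ψ) → Γ ⊩ indep ψ φ
  impossible-indep {φ = φ} {ψ} ◇φ □¬ψ =
    □-map₃ (tautology (~ x₀ ⟺ x₁ ⟹ x₀ ⟹ ~ x₂ ⟹ x₁ ⟺ x₂) (cond (¬' ψ) φ ∷ cond ψ φ ∷ ψ ∷ []) tt)
      (thm (m1 (b4 _ _))) (□-cond ◇φ (□-map (c1 _ _) □¬ψ)) □¬ψ

  indep-of-impossible : Γ ⊩ □ (¬' φ) → Γ ⊩ indep ψ φ
  indep-of-impossible {ψ = ψ} □¬φ = byCases (□ (¬' ψ))
    (indep-¬ (indep-sym (impossible-indep (□⇒◇ hyp₀) (weaken □¬φ))))
    (indep-sym (impossible-indep hyp₀ (weaken □¬φ)))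

  cond-indep-antecedent : Γ ⊩ indep (cond φ ψ) ψ
  cond-indep-antecedent {ψ = ψ} = byCases (□ (¬' ψ))
    (indep-of-impossible hyp₀)
    (□-cond-cong hyp₀ (thm (m1 antecedent⇒cond⇔)))

  indep-congˡ : Γ ⊩ □ (ψ ⇔ η) → Γ ⊩ indep ψ φ → Γ ⊩ indep η φ
  indep-congˡ {φ = φ} □ψ⇔η ψ×φ = byCases (□ (¬' φ))
    (indep-of-impossible hyp₀)
    (□⇔-trans (□⇔-sym (□-cond-cong hyp₀ (□-map (c1 _ _) (weaken □ψ⇔η))))
              (□⇔-trans (weaken ψ×φ) (weaken □ψ⇔η)))

  indep-congʳ : Γ ⊩ □ (ψ ⇔ η) → Γ ⊩ indep φ ψ → Γ ⊩ indep φ η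
  indep-congʳ □ψ⇔η φ×ψ = indep-sym (indep-congˡ □ψ⇔η (indep-sym φ×ψ))

  □-cond-congʳ : Γ ⊩ □ (ψ ⇔ η) → Γ ⊩ □ (cond φ ψ ⇔ cond φ η)
  □-cond-congʳ {Γ = Γ} {ψ} {η} {φ} □ψ⇔η = byCases (□ (¬' ψ)) impossible possible
    where
    impossible : (□ (¬' ψ) ∷ Γ) ⊩ □ (cond φ ψ ⇔ cond φ η)
    impossible = □⇔-trans (indep-of-impossible hyp₀) (□⇔-sym (indep-of-impossible □¬η))
      where
      □¬η : (□ (¬' ψ) ∷ Γ) ⊩ □ (¬' η)
      □¬η = □-map₂ (tautology (x₀ ⟺ x₁ ⟹ ~ x₀ ⟹ ~ x₁) (ψ ∷ η ∷ []) tt) (weaken □ψ⇔η) hyp₀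

    possible : (◇ ψ ∷ Γ) ⊩ □ (cond φ ψ ⇔ cond φ η)
    possible = □⇔-trans (□⇔-sym (indep-congʳ (weaken □ψ⇔η) cond-indep-antecedent))
                        (□-cond-cong ◇η □η⇒cond⇔)
      where
      ◇η : (◇ ψ ∷ Γ) ⊩ ◇ η
      ◇η = ◇-map (□-map (⇔-to _ _) (weaken □ψ⇔η)) hyp₀
      □η⇒cond⇔ : (◇ ψ ∷ Γ) ⊩ □ (η ⇒ (cond φ ψ ⇔ φ))
      □η⇒cond⇔ = □-map₂
        (tautology (x₀ ⟺ x₁ ⟹ (x₀ ⟹ x₂) ⟹ x₁ ⟹ x₂) (ψ ∷ η ∷ (cond φ ψ ⇔ φ) ∷ []) tt)
        (weaken □ψ⇔η) (thm (m1 antecedent⇒cond⇔))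

mainTheorem11 : {Θ : Set} (θ₀ : Θ) → let open Abbrev θ₀ in
    ((φ ψ η : Form Θ) → ⊢ (□ (ψ ⇔ η) ⇒ □ (cond φ ψ ⇔ cond φ η)))
    × ((φ ψ η : Form Θ) → ψ ≡L η → cond φ ψ ≡L cond φ η)
mainTheorem11 θ₀ =
    (λ φ ψ η → theorem (deduction (□-cond-congʳ hyp₀)))
  , (λ φ ψ η ψ≡η → theorem (thm (m3 _) · □-cond-congʳ (thm (m1 ψ≡η))))
  where
  open Abbrev θ₀
  open DmBL θ₀
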